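{- Let $h(n)$ denote the number of maximal independent sets of the meta-hexagonal cactus $H(n)$. Then $h(1)=5$, $h(2)=19$, $h(3)=64$, $h(4)=221$, $h(5)=765$, and $h(n)=3h(n-1)+h(n-2)+2h(n-3)$ for all $n\ge 6$.
   Context: For $n\ge 1$, the meta-hexagonal cactus $H(n)$ is the graph formed by a chain of $n$ 6-cycles $B_1,\dots,B_n$, where for each $1\le i\le n-1$ the consecutive cycles $B_i$ and $B_{i+1}$ share exactly one vertex, non-consecutive cycles share no vertex, every vertex lies in at most two cycles, and for each $2\le i\le n-1$ the two shared (cut) vertices of $B_i$ are at distance two in $B_i$. An independent set is maximal if no further vertex can be added while keeping it independent. -}

module Defs where

open import Data.Nat using (ℕ; zero; suc; _+_; _*_)
import Data.Nat as ℕ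
open import Data.Product using (_×_; _,_; ∃-syntax)
open import Data.Product.Properties using (≡-dec)
open import Data.Sum using (_⊎_)
open import Data.List using (List; []; _∷_; _++_; map; concatMap; upTo; length; filter)
open import Data.List.Membership.DecPropositional (≡-dec ℕ._≟_ ℕ._≟_) using (_∈_; _∈?_)
open import Data.Fin using (Fin; toℕ)
open import Data.Fin.Subset using (Subset; outside; inside; _∪_; ⁅_⁆) renaming (_∈_ to _∈ₛ_; _∉_ to _∉ₛ_)
open import Data.Fin.Subset.Properties
  using () renaming (_∈?_ to _∈ₛ?_)
open import Data.Fin.Properties using (all?)
open import Data.Vec using ([]; _∷_)
open import Relation.Nullary using (Dec; ¬_; ¬?)
open import Relation.Nullary.Decidable using (_⊎-dec_; _→-dec_; _×-dec_)

-- Number of vertices of H(n): n six-cycles chained, consecutive ones sharing one vertex.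
nVert : ℕ → ℕ
nVert n = 5 * n + 1

-- Edges of the i-th 6-cycle B_{i+1} (i = 0 .. n-1).  The cut vertex shared
-- with the previous cycle is 5i, the one shared with the next cycle is 5i+5;
-- they are at distance two in the cycle (via 5i+1).
cycleEdges : ℕ → List (ℕ × ℕ)
cycleEdges i =
  (5 * i , 5 * i + 1) ∷ (5 * i + 1 , 5 * i + 5) ∷ (5 * i + 5 , 5 * i + 2) ∷
  (5 * i + 2 , 5 * i + 3) ∷ (5 * i + 3 , 5 * i + 4) ∷ (5 * i + 4 , 5 * i) ∷ []

edges : ℕ → List (ℕ × ℕ)
edges n = concatMap cycleEdges (upTo n)

Adj : (n : ℕ) → Fin (nVert n) → Fin (nVert n) → Set
Adj n u v = ((toℕ u , toℕ v) ∈ edges n) ⊎ ((toℕ v , toℕ u) ∈ edges n)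

adj? : (n : ℕ) (u v : Fin (nVert n)) → Dec (Adj n u v)
adj? n u v = ((toℕ u , toℕ v) ∈? edges n) ⊎-dec ((toℕ v , toℕ u) ∈? edges n)

Independent : (n : ℕ) → Subset (nVert n) → Set
Independent n S = ∀ u v → u ∈ₛ S → v ∈ₛ S → ¬ Adj n u v

-- Maximal independent set: independent, and adding any vertex outside S
-- destroys independence (equivalently, as written: every non-member has a
-- neighbour in S -- we use the literal "cannot be added" form below).
addVertex : ∀ {m} → Subset m → Fin m → Subset m
addVertex S v = S ∪ ⁅ v ⁆

MaximalIndependent : (n : ℕ) → Subset (nVert n) → Set
MaximalIndependent n S =
  Independent n S × (∀ v → v ∉ₛ S → ¬ Independent n (addVertex S v))

independent? : (n : ℕ) (S : Subset (nVert n)) → Dec (Independent n S)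
independent? n S =
  all? (λ u → all? (λ v → (u ∈ₛ? S) →-dec ((v ∈ₛ? S) →-dec ¬? (adj? n u v))))

maximalIndependent? : (n : ℕ) (S : Subset (nVert n)) → Dec (MaximalIndependent n S)
maximalIndependent? n S =
  independent? n S ×-dec
    (all? (λ v → ¬? (v ∈ₛ? S) →-dec ¬? (independent? n (addVertex S v))))

allSubsets : (m : ℕ) → List (Subset m)
allSubsets zero = [] ∷ []
allSubsets (suc m) = map (outside ∷_) (allSubsets m) ++ map (inside ∷_) (allSubsets m)

h : ℕ → ℕ
h n = length (filter (maximalIndependent? n) (allSubsets (nVert n)))

{-# OPTIONS --safe #-}
-- A vertex set of H(n) is coded as a bit list, and maximal independence as the Boolean test
-- "independent, and every vertex is chosen or has a chosen neighbour".  Cutting H(n+1) at the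
-- shared vertex of B₁ and B₂ splits this test into a local condition on B₁ and the same test on the
-- remaining copy of H(n), except that its first vertex counts as dominated from outside exactly
-- when one of its two neighbours in B₁ is chosen.  So the numbers (a, b, c) of maximal independent
-- sets with first vertex (not chosen, not externally dominated), (chosen, not externally dominated),
-- (not chosen, externally dominated) evolve by (a, b, c) ↦ (b + 2c, a + b + c, 2b + 2c) from
-- (0, 1, 1), and h = a + b.  The characteristic polynomial x³ - 3x² - x - 2 of this linear map
-- gives the recurrence.

module Submission where

open import Defs
open import Data.Nat using (ℕ; zero; suc; _+_; _*_; _≥_; _∸_; _<_; _≡ᵇ_; s≤s)
open import Data.Product using (_×_; _,_; proj₁; proj₂; ∃-syntax)
open import Relation.Binary.PropositionalEquality
  using (_≡_; refl; sym; trans; cong; cong₂; subst; module ≡-Reasoning)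

open import Algebra.Bundles using (CommutativeMonoid)
open import Data.Bool using (Bool; true; false; _∧_; _∨_; not; if_then_else_; T)
open import Data.Bool.ListAction using (and; or; all; any)
open import Data.Bool.Properties using (T-∧; T-∨; ∧-assoc; ∨-assoc; ∨-identityʳ; ∧-commutativeMonoid)
open import Data.Empty using (⊥; ⊥-elim)
open import Data.Fin using (toℕ; fromℕ<) renaming (zero to fzero; suc to fsuc)
open import Data.Fin.Properties using (toℕ-injective; toℕ-fromℕ<; toℕ<n)
open import Data.Fin.Subset using (Subset; ⁅_⁆) renaming (_∈_ to _∈ₛ_; _∉_ to _∉ₛ_)
open import Data.Fin.Subset.Properties using (x∈p∪q⁻; p⊆p∪q; q⊆p∪q; x∈⁅x⁆; x∈⁅y⁆⇒x≡y)
open import Data.List using (List; []; _∷_; _++_; map; length; filter; concatMap; applyUpTo; upTo)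
open import Data.List.Properties using (map-++; map-∘; length-++; filter-++)
open import Data.List.Membership.Propositional using (_∈_; _∉_; find; lose)
open import Data.List.Membership.Propositional.Properties using (∈-upTo⁺; ∈-upTo⁻)
open import Data.List.Relation.Unary.All as All using ()
open import Data.List.Relation.Unary.All.Properties using (all⁺; all⁻)
open import Data.List.Relation.Unary.Any as Any using (here; there)
open import Data.List.Relation.Unary.Any.Properties using (any⁺; any⁻; concatMap⁻)
open import Data.Nat.GeneralisedArithmetic using (fold)
open import Data.Nat.Properties using (*-suc; +-comm; +-cancelˡ-≡; m+1+n≢m; ≡ᵇ⇒≡; ≡⇒≡ᵇ)
open import Data.Nat.Tactic.RingSolver using (solve-∀)
open import Data.Sum using (inj₁; inj₂)
open import Data.Vec using ([]; _∷_; toList; here; there)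
open import Function using (id; _∘_; _⇔_; mk⇔; Equivalence)
open import Relation.Nullary using (Dec; yes; no; ¬_)
open import Relation.Nullary.Decidable using (T?)
open import Relation.Unary using (Pred; Decidable)

open Equivalence using (to; from)
open import Algebra.Properties.CommutativeSemigroup
  (CommutativeMonoid.commutativeSemigroup ∧-commutativeMonoid) using (interchange)

-- Counting bit lists

count : ℕ → (List Bool → Bool) → ℕ
count zero    F = if F [] then 1 else 0
count (suc m) F = count m (F ∘ (false ∷_)) + count m (F ∘ (true ∷_))

count-cong : ∀ m {F G : List Bool → Bool} → (∀ r → F r ≡ G r) → count m F ≡ count m G
count-cong zero    F≗G rewrite F≗G [] = refl
count-cong (suc m) F≗G =
  cong₂ _+_ (count-cong m (F≗G ∘ (false ∷_))) (count-cong m (F≗G ∘ (true ∷_)))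

count-false : ∀ m → count m (λ _ → false) ≡ 0
count-false zero    = refl
count-false (suc m) = cong₂ _+_ (count-false m) (count-false m)

count-∧ : ∀ m c (F : List Bool → Bool) → count m (λ r → c ∧ F r) ≡ (if c then count m F else 0)
count-∧ m false F = count-false m
count-∧ m true  F = refl

length-filter-map : ∀ {a b p} {A : Set a} {B : Set b} {P : Pred B p} (P? : Decidable P) (f : A → B) xs →
                    length (filter P? (map f xs)) ≡ length (filter (P? ∘ f) xs)
length-filter-map P? f []       = refl
length-filter-map P? f (x ∷ xs) with Dec.does (P? (f x))
... | true  = cong suc (length-filter-map P? f xs)
... | false = length-filter-map P? f xs

length-filter-allSubsets : ∀ m {p} {P : Pred (Subset m) p} (P? : Decidable P) (F : List Bool → Bool) →
                           (∀ S → P S ⇔ T (F (toList S))) →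
                           length (filter P? (allSubsets m)) ≡ count m F
length-filter-allSubsets zero P? F P⇔F with P? [] | F [] | P⇔F []
... | yes _  | true  | _    = refl
... | yes p  | false | P⇔F′ = ⊥-elim (to P⇔F′ p)
... | no ¬p  | true  | P⇔F′ = ⊥-elim (¬p (from P⇔F′ _))
... | no _   | false | _    = refl
length-filter-allSubsets (suc m) P? F P⇔F = begin
  length (filter P? (map (false ∷_) A ++ map (true ∷_) A))
    ≡⟨ cong length (filter-++ P? (map (false ∷_) A) _) ⟩
  length (filter P? (map (false ∷_) A) ++ filter P? (map (true ∷_) A))
    ≡⟨ length-++ (filter P? (map (false ∷_) A)) ⟩
  length (filter P? (map (false ∷_) A)) + length (filter P? (map (true ∷_) A))
    ≡⟨ cong₂ _+_ (length-filter-map P? (false ∷_) A) (length-filter-map P? (true ∷_) A) ⟩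
  length (filter (P? ∘ (false ∷_)) A) + length (filter (P? ∘ (true ∷_)) A)
    ≡⟨ cong₂ _+_ (length-filter-allSubsets m _ _ (P⇔F ∘ (false ∷_)))
                 (length-filter-allSubsets m _ _ (P⇔F ∘ (true ∷_))) ⟩
  count (suc m) F ∎
  where
    open ≡-Reasoning
    A = allSubsets m

-- Maximal independence as a Boolean test on bit lists

bitAt : List Bool → ℕ → Bool
bitAt []      _       = false
bitAt (b ∷ _) zero    = b
bitAt (_ ∷ l) (suc k) = bitAt l k

notBothᵇ : List Bool → ℕ × ℕ → Bool
notBothᵇ l (a , b) = not (bitAt l a ∧ bitAt l b)

independentᵇ : ℕ → List Bool → Bool
independentᵇ n l = all (notBothᵇ l) (edges n)

linksᵇ : List Bool → ℕ → ℕ × ℕ → Bool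
linksᵇ l v (a , b) = (a ≡ᵇ v) ∧ bitAt l b ∨ (b ≡ᵇ v) ∧ bitAt l a

hasNeighbourᵇ : ℕ → List Bool → ℕ → Bool
hasNeighbourᵇ n l v = any (linksᵇ l v) (edges n)

-- d records whether vertex 0 is already dominated from outside H(n).
dominatedᵇ : ℕ → Bool → List Bool → ℕ → Bool
dominatedᵇ n d l v = bitAt l v ∨ (v ≡ᵇ 0) ∧ d ∨ hasNeighbourᵇ n l v

dominatingᵇ : ℕ → Bool → List Bool → Bool
dominatingᵇ n d l = all (dominatedᵇ n d l) (upTo (nVert n))

maximalIndependentᵇ : ℕ → Bool → List Bool → Bool
maximalIndependentᵇ n d l = independentᵇ n l ∧ dominatingᵇ n d l

∈⇒bitAt : ∀ {m} {S : Subset m} {i} → i ∈ₛ S → T (bitAt (toList S) (toℕ i))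
∈⇒bitAt here      = _
∈⇒bitAt (there p) = ∈⇒bitAt p

bitAt⇒∃∈ : ∀ {m} {S : Subset m} {k} → T (bitAt (toList S) k) → ∃[ i ] toℕ i ≡ k × i ∈ₛ S
bitAt⇒∃∈ {S = true ∷ S} {zero}  _ = fzero , refl , here
bitAt⇒∃∈ {S = _ ∷ S}    {suc k} t with bitAt⇒∃∈ {S = S} t
... | i , refl , i∈S = fsuc i , refl , there i∈S

bitAt⇒∈ : ∀ {m} {S : Subset m} {i} → T (bitAt (toList S) (toℕ i)) → i ∈ₛ S
bitAt⇒∈ {S = S} t with bitAt⇒∃∈ {S = S} t
... | j , j≡i , j∈S = subst (_∈ₛ S) (toℕ-injective j≡i) j∈S

T-nand⁺ : ∀ {a b} → (T a → T b → ⊥) → T (not (a ∧ b))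
T-nand⁺ {true}  {true}  a∧b⇒⊥ = a∧b⇒⊥ _ _
T-nand⁺ {true}  {false} _     = _
T-nand⁺ {false}         _     = _

T-nand⁻ : ∀ {a b} → T (not (a ∧ b)) → T a → T b → ⊥
T-nand⁻ {true} {true} ()

Adj-sym : ∀ n {u v} → Adj n u v → Adj n v u
Adj-sym n (inj₁ uv) = inj₂ uv
Adj-sym n (inj₂ vu) = inj₁ vu

diagonal : ∀ {a x y : ℕ} → (a , a) ≡ (x , y) → x ≡ y
diagonal refl = refl

cycleEdges-irreflexive : ∀ i {a} → (a , a) ∉ cycleEdges i
cycleEdges-irreflexive i (here e) = m+1+n≢m (5 * i) (sym (diagonal e))
cycleEdges-irreflexive i (there (here e)) with () ← +-cancelˡ-≡ (5 * i) 1 5 (diagonal e)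
cycleEdges-irreflexive i (there (there (here e))) with () ← +-cancelˡ-≡ (5 * i) 5 2 (diagonal e)
cycleEdges-irreflexive i (there (there (there (here e)))) with () ← +-cancelˡ-≡ (5 * i) 2 3 (diagonal e)
cycleEdges-irreflexive i (there (there (there (there (here e))))) with () ← +-cancelˡ-≡ (5 * i) 3 4 (diagonal e)
cycleEdges-irreflexive i (there (there (there (there (there (here e)))))) = m+1+n≢m (5 * i) (diagonal e)

edges-irreflexive : ∀ n {a} → (a , a) ∉ edges n
edges-irreflexive n p with Any.satisfied (concatMap⁻ cycleEdges {xs = upTo n} p)
... | i , aa∈ = cycleEdges-irreflexive i aa∈

Adj-irreflexive : ∀ n {v} → ¬ Adj n v v
Adj-irreflexive n (inj₁ vv) = edges-irreflexive n vv
Adj-irreflexive n (inj₂ vv) = edges-irreflexive n vv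

module _ (n : ℕ) (S : Subset (nVert n)) where

  independent⇒independentᵇ : Independent n S → T (independentᵇ n (toList S))
  independent⇒independentᵇ ind = all⁻ _ (All.tabulate edgeOK)
    where
      edgeOK : ∀ {e} → e ∈ edges n → T (notBothᵇ (toList S) e)
      edgeOK {a , b} ab∈ = T-nand⁺ bothIn
        where
          bothIn : T (bitAt (toList S) a) → T (bitAt (toList S) b) → ⊥
          bothIn ta tb with bitAt⇒∃∈ {S = S} ta | bitAt⇒∃∈ {S = S} tb
          ... | i , refl , i∈S | j , refl , j∈S = ind i j i∈S j∈S (inj₁ ab∈)

  independentᵇ⇒independent : T (independentᵇ n (toList S)) → Independent n S
  independentᵇ⇒independent t u v u∈S v∈S (inj₁ uv∈) =
    T-nand⁻ (All.lookup (all⁺ _ _ t) uv∈) (∈⇒bitAt u∈S) (∈⇒bitAt v∈S)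
  independentᵇ⇒independent t u v u∈S v∈S (inj₂ vu∈) =
    T-nand⁻ (All.lookup (all⁺ _ _ t) vu∈) (∈⇒bitAt v∈S) (∈⇒bitAt u∈S)

  neighbour⇒hasNeighbourᵇ : ∀ {u v} → u ∈ₛ S → Adj n v u →
                            T (hasNeighbourᵇ n (toList S) (toℕ v))
  neighbour⇒hasNeighbourᵇ {u} {v} u∈S (inj₁ vu∈) =
    any⁺ _ (lose vu∈ (from T-∨ (inj₁ (from T-∧ (≡⇒≡ᵇ (toℕ v) (toℕ v) refl , ∈⇒bitAt u∈S)))))
  neighbour⇒hasNeighbourᵇ {u} {v} u∈S (inj₂ uv∈) =
    any⁺ _ (lose uv∈ (from T-∨ (inj₂ (from T-∧ (≡⇒≡ᵇ (toℕ v) (toℕ v) refl , ∈⇒bitAt u∈S)))))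

  hasNeighbourᵇ⇒neighbour : ∀ {v} → T (hasNeighbourᵇ n (toList S) (toℕ v)) →
                            ∃[ u ] u ∈ₛ S × Adj n v u
  hasNeighbourᵇ⇒neighbour {v} t with find (any⁻ _ (edges n) t)
  ... | (a , b) , ab∈ , link with to T-∨ link
  ... | inj₁ link₁ with to T-∧ link₁
  ...   | a≡v , tb with ≡ᵇ⇒≡ a (toℕ v) a≡v | bitAt⇒∃∈ {S = S} tb
  ...     | refl | j , refl , j∈S = j , j∈S , inj₁ ab∈
  hasNeighbourᵇ⇒neighbour {v} t | (a , b) , ab∈ , link | inj₂ link₂ with to T-∧ link₂
  ...   | b≡v , ta with ≡ᵇ⇒≡ b (toℕ v) b≡v | bitAt⇒∃∈ {S = S} ta
  ...     | refl | j , refl , j∈S = j , j∈S , inj₂ ab∈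

  insert-independent : ∀ {v} → Independent n S → (∀ {u} → u ∈ₛ S → ¬ Adj n v u) →
                       Independent n (addVertex S v)
  insert-independent {v} ind isolated u w u∈ w∈ with x∈p∪q⁻ S ⁅ v ⁆ u∈ | x∈p∪q⁻ S ⁅ v ⁆ w∈
  ... | inj₁ u∈S | inj₁ w∈S = ind u w u∈S w∈S
  ... | inj₁ u∈S | inj₂ w≡v with x∈⁅y⁆⇒x≡y v w≡v
  ...   | refl = isolated u∈S ∘ Adj-sym n
  insert-independent {v} ind isolated u w u∈ w∈ | inj₂ u≡v | inj₁ w∈S with x∈⁅y⁆⇒x≡y v u≡v
  ...   | refl = isolated w∈S
  insert-independent {v} ind isolated u w u∈ w∈ | inj₂ u≡v | inj₂ w≡v
    with x∈⁅y⁆⇒x≡y v u≡v | x∈⁅y⁆⇒x≡y v w≡v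
  ...   | refl | refl = Adj-irreflexive n

  maximal⇒dominatedᵇ : MaximalIndependent n S → ∀ v → T (dominatedᵇ n false (toList S) (toℕ v))
  maximal⇒dominatedᵇ (ind , maximal) v
    with T? (bitAt (toList S) (toℕ v)) | T? (hasNeighbourᵇ n (toList S) (toℕ v))
  ... | yes v∈S | _       = from (T-∨ {bitAt (toList S) (toℕ v)}) (inj₁ v∈S)
  ... | no _    | yes nbr =
    from (T-∨ {bitAt (toList S) (toℕ v)}) (inj₂ (from (T-∨ {(toℕ v ≡ᵇ 0) ∧ false}) (inj₂ nbr)))
  ... | no v∉S  | no ¬nbr =
    ⊥-elim (maximal v (v∉S ∘ ∈⇒bitAt)
                       (insert-independent ind (λ u∈S → ¬nbr ∘ neighbour⇒hasNeighbourᵇ u∈S)))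

  maximal⇒dominatingᵇ : MaximalIndependent n S → T (dominatingᵇ n false (toList S))
  maximal⇒dominatingᵇ mis = all⁻ _ (All.tabulate λ k∈ →
    subst (T ∘ dominatedᵇ n false (toList S)) (toℕ-fromℕ< (∈-upTo⁻ k∈))
          (maximal⇒dominatedᵇ mis (fromℕ< (∈-upTo⁻ k∈))))

  dominatingᵇ⇒maximal : T (dominatingᵇ n false (toList S)) →
                        ∀ v → v ∉ₛ S → ¬ Independent n (addVertex S v)
  dominatingᵇ⇒maximal t v v∉S ind′ with to T-∨ (All.lookup (all⁺ _ _ t) (∈-upTo⁺ (toℕ<n v)))
  ... | inj₁ v∈S = v∉S (bitAt⇒∈ v∈S)
  ... | inj₂ rest with to T-∨ rest
  ...   | inj₁ external = proj₂ (to T-∧ external)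
  ...   | inj₂ nbr with hasNeighbourᵇ⇒neighbour nbr
  ...     | u , u∈S , vu = ind′ v u (q⊆p∪q S ⁅ v ⁆ (x∈⁅x⁆ v)) (p⊆p∪q ⁅ v ⁆ u∈S) vu

maximalIndependent⇔ᵇ : ∀ n (S : Subset (nVert n)) →
                       MaximalIndependent n S ⇔ T (maximalIndependentᵇ n false (toList S))
maximalIndependent⇔ᵇ n S = mk⇔
  (λ mis → from (T-∧ {independentᵇ n (toList S)})
              (independent⇒independentᵇ n S (proj₁ mis) , maximal⇒dominatingᵇ n S mis))
  (λ t → let ind , dom = to (T-∧ {independentᵇ n (toList S)}) t
         in independentᵇ⇒independent n S ind , dominatingᵇ⇒maximal n S dom)

-- Peeling off the first hexagon

all-++ : ∀ {a} {A : Set a} (p : A → Bool) xs ys → all p (xs ++ ys) ≡ all p xs ∧ all p ys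
all-++ p []       ys = refl
all-++ p (x ∷ xs) ys = trans (cong (p x ∧_) (all-++ p xs ys)) (sym (∧-assoc (p x) _ _))

any-++ : ∀ {a} {A : Set a} (p : A → Bool) xs ys → any p (xs ++ ys) ≡ any p xs ∨ any p ys
any-++ p []       ys = refl
any-++ p (x ∷ xs) ys = trans (cong (p x ∨_) (any-++ p xs ys)) (sym (∨-assoc (p x) _ _))

all-map : ∀ {a b} {A : Set a} {B : Set b} (p : B → Bool) (f : A → B) xs → all p (map f xs) ≡ all (p ∘ f) xs
all-map p f xs = cong and (sym (map-∘ xs))

any-map : ∀ {a b} {A : Set a} {B : Set b} (p : B → Bool) (f : A → B) xs → any p (map f xs) ≡ any (p ∘ f) xs
any-map p f xs = cong or (sym (map-∘ xs))

all-cong : ∀ {a} {A : Set a} {p q : A → Bool} xs → (∀ {x} → x ∈ xs → p x ≡ q x) → all p xs ≡ all q xs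
all-cong []       _   = refl
all-cong (x ∷ xs) p≗q = cong₂ _∧_ (p≗q (here refl)) (all-cong xs (p≗q ∘ there))

any-false : ∀ {a} {A : Set a} {p : A → Bool} xs → (∀ x → p x ≡ false) → any p xs ≡ false
any-false []       _  = refl
any-false (x ∷ xs) p≗false rewrite p≗false x = any-false xs p≗false

applyUpTo-∘ : ∀ {a} {A : Set a} (f : ℕ → A) (g : ℕ → ℕ) n → applyUpTo (f ∘ g) n ≡ map f (applyUpTo g n)
applyUpTo-∘ f g zero    = refl
applyUpTo-∘ f g (suc n) = cong (f (g 0) ∷_) (applyUpTo-∘ f (g ∘ suc) n)

shift : ℕ → ℕ × ℕ → ℕ × ℕ
shift k (a , b) = (k + a , k + b)

cycleEdges-suc : ∀ i → cycleEdges (suc i) ≡ map (shift 5) (cycleEdges i)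
cycleEdges-suc i = cong hexagonAt (*-suc 5 i)
  where
    hexagonAt : ℕ → List (ℕ × ℕ)
    hexagonAt a = (a , a + 1) ∷ (a + 1 , a + 5) ∷ (a + 5 , a + 2) ∷
                  (a + 2 , a + 3) ∷ (a + 3 , a + 4) ∷ (a + 4 , a) ∷ []

edges-suc : ∀ n → edges (suc n) ≡ cycleEdges 0 ++ map (shift 5) (edges n)
edges-suc n = cong (cycleEdges 0 ++_) (shifted id n)
  where
    shifted : ∀ f n → concatMap cycleEdges (applyUpTo (suc ∘ f) n) ≡
                      map (shift 5) (concatMap cycleEdges (applyUpTo f n))
    shifted f zero    = refl
    shifted f (suc n) = begin
      cycleEdges (suc (f 0)) ++ concatMap cycleEdges (applyUpTo (suc ∘ f ∘ suc) n)
        ≡⟨ cong₂ _++_ (cycleEdges-suc (f 0)) (shifted (f ∘ suc) n) ⟩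
      map (shift 5) (cycleEdges (f 0)) ++ map (shift 5) (concatMap cycleEdges (applyUpTo (f ∘ suc) n))
        ≡⟨ sym (map-++ (shift 5) (cycleEdges (f 0)) _) ⟩
      map (shift 5) (concatMap cycleEdges (applyUpTo f (suc n))) ∎
      where open ≡-Reasoning

-- The cut vertex 5 need not be dominated inside B₁: that is left to the next hexagon.
hexagonᵇ : Bool → List Bool → Bool
hexagonᵇ d l = independentᵇ 1 l ∧ all (dominatedᵇ 1 d l) (upTo 5)

hubLinks : ∀ b₀ x₁ x₂ x₃ x₄ b₅ r j →
           any (linksᵇ (b₀ ∷ x₁ ∷ x₂ ∷ x₃ ∷ x₄ ∷ b₅ ∷ r) (5 + j)) (cycleEdges 0) ≡ (j ≡ᵇ 0) ∧ (x₁ ∨ x₂)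
hubLinks _ true  _     _ _ _ _ zero    = refl
hubLinks _ false true  _ _ _ _ zero    = refl
hubLinks _ false false _ _ _ _ zero    = refl
hubLinks _ _     _     _ _ _ _ (suc j) = refl

module _ (n : ℕ) (d b₀ x₁ x₂ x₃ x₄ b₅ : Bool) (r : List Bool) where

  private
    whole hexagon rest : List Bool
    whole   = b₀ ∷ x₁ ∷ x₂ ∷ x₃ ∷ x₄ ∷ b₅ ∷ r
    hexagon = b₀ ∷ x₁ ∷ x₂ ∷ x₃ ∷ x₄ ∷ b₅ ∷ []
    rest    = b₅ ∷ r

  independentᵇ-peel : independentᵇ (suc n) whole ≡ independentᵇ 1 hexagon ∧ independentᵇ n rest
  independentᵇ-peel = begin
    all (notBothᵇ whole) (edges (suc n))
      ≡⟨ cong (all (notBothᵇ whole)) (edges-suc n) ⟩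
    all (notBothᵇ whole) (cycleEdges 0 ++ map (shift 5) (edges n))
      ≡⟨ all-++ (notBothᵇ whole) (cycleEdges 0) (map (shift 5) (edges n)) ⟩
    all (notBothᵇ whole) (cycleEdges 0) ∧ all (notBothᵇ whole) (map (shift 5) (edges n))
      ≡⟨ cong (all (notBothᵇ whole) (cycleEdges 0) ∧_) (all-map (notBothᵇ whole) (shift 5) (edges n)) ⟩
    independentᵇ 1 hexagon ∧ independentᵇ n rest ∎
    where open ≡-Reasoning

  hasNeighbourᵇ-peel : ∀ v → hasNeighbourᵇ (suc n) whole v ≡
                       any (linksᵇ whole v) (cycleEdges 0) ∨ any (linksᵇ whole v ∘ shift 5) (edges n)
  hasNeighbourᵇ-peel v = begin
    any (linksᵇ whole v) (edges (suc n))
      ≡⟨ cong (any (linksᵇ whole v)) (edges-suc n) ⟩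
    any (linksᵇ whole v) (cycleEdges 0 ++ map (shift 5) (edges n))
      ≡⟨ any-++ (linksᵇ whole v) (cycleEdges 0) (map (shift 5) (edges n)) ⟩
    any (linksᵇ whole v) (cycleEdges 0) ∨ any (linksᵇ whole v) (map (shift 5) (edges n))
      ≡⟨ cong (any (linksᵇ whole v) (cycleEdges 0) ∨_) (any-map (linksᵇ whole v) (shift 5) (edges n)) ⟩
    any (linksᵇ whole v) (cycleEdges 0) ∨ any (linksᵇ whole v ∘ shift 5) (edges n) ∎
    where open ≡-Reasoning

  dominatedᵇ-local : ∀ k → (∀ e → linksᵇ whole k (shift 5 e) ≡ false) →
    bitAt whole k ∨ (k ≡ᵇ 0) ∧ d ∨ any (linksᵇ whole k) (cycleEdges 0) ≡ dominatedᵇ 1 d hexagon k →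
    dominatedᵇ (suc n) d whole k ≡ dominatedᵇ 1 d hexagon k
  dominatedᵇ-local k noFarLinks nearby = trans
    (cong (λ x → bitAt whole k ∨ (k ≡ᵇ 0) ∧ d ∨ x) (begin
      hasNeighbourᵇ (suc n) whole k
        ≡⟨ hasNeighbourᵇ-peel k ⟩
      any (linksᵇ whole k) (cycleEdges 0) ∨ any (linksᵇ whole k ∘ shift 5) (edges n)
        ≡⟨ cong (any (linksᵇ whole k) (cycleEdges 0) ∨_) (any-false (edges n) noFarLinks) ⟩
      any (linksᵇ whole k) (cycleEdges 0) ∨ false
        ≡⟨ ∨-identityʳ _ ⟩
      any (linksᵇ whole k) (cycleEdges 0) ∎))
    nearby
    where open ≡-Reasoning

  dominatedᵇ-near : ∀ {k} → k < 5 → dominatedᵇ (suc n) d whole k ≡ dominatedᵇ 1 d hexagon k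
  dominatedᵇ-near {0} _ = dominatedᵇ-local 0 (λ _ → refl) refl
  dominatedᵇ-near {1} _ = dominatedᵇ-local 1 (λ _ → refl) refl
  dominatedᵇ-near {2} _ = dominatedᵇ-local 2 (λ _ → refl) refl
  dominatedᵇ-near {3} _ = dominatedᵇ-local 3 (λ _ → refl) refl
  dominatedᵇ-near {4} _ = dominatedᵇ-local 4 (λ _ → refl) refl
  dominatedᵇ-near {suc (suc (suc (suc (suc _))))} (s≤s (s≤s (s≤s (s≤s (s≤s ())))))

  dominatedᵇ-far : ∀ j → dominatedᵇ (suc n) d whole (5 + j) ≡ dominatedᵇ n (x₁ ∨ x₂) rest j
  dominatedᵇ-far j = cong (bitAt rest j ∨_)
    (trans (hasNeighbourᵇ-peel (5 + j))
           (cong (_∨ hasNeighbourᵇ n rest j) (hubLinks b₀ x₁ x₂ x₃ x₄ b₅ r j)))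

  dominatingᵇ-peel : dominatingᵇ (suc n) d whole ≡
                     all (dominatedᵇ 1 d hexagon) (upTo 5) ∧ dominatingᵇ n (x₁ ∨ x₂) rest
  dominatingᵇ-peel = begin
    all D (upTo (nVert (suc n)))
      ≡⟨ cong (λ m → all D (upTo (m + 1))) (*-suc 5 n) ⟩
    all D (upTo 5 ++ applyUpTo (5 +_) (nVert n))
      ≡⟨ all-++ D (upTo 5) (applyUpTo (5 +_) (nVert n)) ⟩
    all D (upTo 5) ∧ all D (applyUpTo (5 +_) (nVert n))
      ≡⟨ cong₂ _∧_ (all-cong (upTo 5) (dominatedᵇ-near ∘ ∈-upTo⁻)) far ⟩
    all (dominatedᵇ 1 d hexagon) (upTo 5) ∧ dominatingᵇ n (x₁ ∨ x₂) rest ∎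
    where
      open ≡-Reasoning
      D = dominatedᵇ (suc n) d whole
      far : all D (applyUpTo (5 +_) (nVert n)) ≡ dominatingᵇ n (x₁ ∨ x₂) rest
      far = begin
        all D (applyUpTo (5 +_) (nVert n))
          ≡⟨ cong (all D) (applyUpTo-∘ (5 +_) id (nVert n)) ⟩
        all D (map (5 +_) (upTo (nVert n)))
          ≡⟨ all-map D (5 +_) (upTo (nVert n)) ⟩
        all (D ∘ (5 +_)) (upTo (nVert n))
          ≡⟨ all-cong (upTo (nVert n)) (λ {j} _ → dominatedᵇ-far j) ⟩
        dominatingᵇ n (x₁ ∨ x₂) rest ∎

  maximalIndependentᵇ-peel : maximalIndependentᵇ (suc n) d whole ≡
                             hexagonᵇ d hexagon ∧ maximalIndependentᵇ n (x₁ ∨ x₂) rest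
  maximalIndependentᵇ-peel =
    trans (cong₂ _∧_ independentᵇ-peel dominatingᵇ-peel)
      (interchange (independentᵇ 1 hexagon) (independentᵇ n rest)
                   (all (dominatedᵇ 1 d hexagon) (upTo 5)) (dominatingᵇ n (x₁ ∨ x₂) rest))

-- The transfer recurrence

Σᵇ : (Bool → ℕ) → ℕ
Σᵇ f = f false + f true

Σᵇ-cong : ∀ {f g : Bool → ℕ} → (∀ x → f x ≡ g x) → Σᵇ f ≡ Σᵇ g
Σᵇ-cong f≗g = cong₂ _+_ (f≗g false) (f≗g true)

transfer : (Bool → Bool → ℕ) → Bool → Bool → ℕ
transfer t d b = Σᵇ λ x₁ → Σᵇ λ x₂ → Σᵇ λ x₃ → Σᵇ λ x₄ → Σᵇ λ b₅ →
  if hexagonᵇ d (b ∷ x₁ ∷ x₂ ∷ x₃ ∷ x₄ ∷ b₅ ∷ []) then t (x₁ ∨ x₂) b₅ else 0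

-- Each left-hand side below is the normal form of the transfer sum: one summand per
-- admissible configuration of B₁, padded with the zeros of the rejected ones.
transfer-ff : ∀ t → transfer t false false ≡ t false true + 2 * t true false
transfer-ff t = admissible (t false true) (t true false)
  where
    admissible : ∀ b c → b + 0 + 0 + (c + 0 + 0 + (c + 0 + 0)) ≡ b + 2 * c
    admissible = solve-∀

transfer-ft : ∀ t → transfer t false true ≡ t false false + t false true + t true false
transfer-ft t = admissible (t false false) (t false true) (t true false)
  where
    admissible : ∀ a b c → a + b + 0 + (c + 0 + 0 + 0) + 0 ≡ a + b + c
    admissible = solve-∀

transfer-tf : ∀ t → transfer t true false ≡ 2 * t false true + 2 * t true false
transfer-tf t = admissible (t false true) (t true false)
  where
    admissible : ∀ b c → b + (b + 0) + 0 + (c + 0 + 0 + (c + 0 + 0)) ≡ 2 * b + 2 * c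
    admissible = solve-∀

rootedCount : ℕ → Bool → Bool → ℕ
rootedCount n d b = count (5 * n) (λ r → maximalIndependentᵇ n d (b ∷ r))

rootedCount-suc : ∀ n d b → rootedCount (suc n) d b ≡ transfer (rootedCount n) d b
rootedCount-suc n d b = begin
  count (5 * suc n) G
    ≡⟨ cong (λ m → count m G) (*-suc 5 n) ⟩
  count (5 + 5 * n) G
    ≡⟨ (Σᵇ-cong λ x₁ → Σᵇ-cong λ x₂ → Σᵇ-cong λ x₃ → Σᵇ-cong λ x₄ → Σᵇ-cong λ b₅ →
          peeled x₁ x₂ x₃ x₄ b₅) ⟩
  transfer (rootedCount n) d b ∎
  where
    open ≡-Reasoning
    G : List Bool → Bool
    G r = maximalIndependentᵇ (suc n) d (b ∷ r)
    peeled : ∀ x₁ x₂ x₃ x₄ b₅ →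
             count (5 * n) (λ r → G (x₁ ∷ x₂ ∷ x₃ ∷ x₄ ∷ b₅ ∷ r)) ≡
             (if hexagonᵇ d (b ∷ x₁ ∷ x₂ ∷ x₃ ∷ x₄ ∷ b₅ ∷ []) then rootedCount n (x₁ ∨ x₂) b₅ else 0)
    peeled x₁ x₂ x₃ x₄ b₅ = trans
      (count-cong (5 * n) (maximalIndependentᵇ-peel n d b x₁ x₂ x₃ x₄ b₅))
      (count-∧ (5 * n) (hexagonᵇ d (b ∷ x₁ ∷ x₂ ∷ x₃ ∷ x₄ ∷ b₅ ∷ []))
               (λ r → maximalIndependentᵇ n (x₁ ∨ x₂) (b₅ ∷ r)))

h≡rootedCount : ∀ n → h n ≡ rootedCount n false false + rootedCount n false true
h≡rootedCount n = trans
  (length-filter-allSubsets (nVert n) (maximalIndependent? n) (maximalIndependentᵇ n false)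
                            (maximalIndependent⇔ᵇ n))
  (cong (λ m → count m (maximalIndependentᵇ n false)) (+-comm (5 * n) 1))

step : ℕ × ℕ × ℕ → ℕ × ℕ × ℕ
step (a , b , c) = b + 2 * c , a + b + c , 2 * b + 2 * c

total : ℕ × ℕ × ℕ → ℕ
total (a , b , _) = a + b

rootedCounts : ℕ → ℕ × ℕ × ℕ
rootedCounts n = rootedCount n false false , rootedCount n false true , rootedCount n true false

rootedCounts≡fold : ∀ n → rootedCounts n ≡ fold (0 , 1 , 1) step n
rootedCounts≡fold zero    = refl
rootedCounts≡fold (suc n) = trans
  (cong₂ _,_ (trans (rootedCount-suc n false false) (transfer-ff (rootedCount n)))
    (cong₂ _,_ (trans (rootedCount-suc n false true) (transfer-ft (rootedCount n)))
               (trans (rootedCount-suc n true false) (transfer-tf (rootedCount n)))))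
  (cong step (rootedCounts≡fold n))

h≡total : ∀ n → h n ≡ total (fold (0 , 1 , 1) step n)
h≡total n = trans (h≡rootedCount n) (cong total (rootedCounts≡fold n))

total-step³ : ∀ a b c →
  let a₁ = b + 2 * c ; b₁ = a + b + c ; c₁ = 2 * b + 2 * c
      a₂ = b₁ + 2 * c₁ ; b₂ = a₁ + b₁ + c₁ ; c₂ = 2 * b₁ + 2 * c₁
      a₃ = b₂ + 2 * c₂ ; b₃ = a₂ + b₂ + c₂
  in a₃ + b₃ ≡ 3 * (a₂ + b₂) + (a₁ + b₁) + 2 * (a + b)
total-step³ = solve-∀

h-recurrence : ∀ k → h (3 + k) ≡ 3 * h (2 + k) + h (1 + k) + 2 * h k
h-recurrence k = begin
  h (3 + k)
    ≡⟨ h≡total (3 + k) ⟩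
  total (step (step (step v)))
    ≡⟨ total-step³ (proj₁ v) (proj₁ (proj₂ v)) (proj₂ (proj₂ v)) ⟩
  3 * total (step (step v)) + total (step v) + 2 * total v
    ≡⟨ sym (cong₂ _+_ (cong₂ _+_ (cong (3 *_) (h≡total (2 + k))) (h≡total (1 + k)))
                      (cong (2 *_) (h≡total k))) ⟩
  3 * h (2 + k) + h (1 + k) + 2 * h k ∎
  where
    open ≡-Reasoning
    v = fold (0 , 1 , 1) step k

theorem2p16 : (h 1 ≡ 5) × (h 2 ≡ 19) × (h 3 ≡ 64) × (h 4 ≡ 221) × (h 5 ≡ 765)
    × (∀ n → n ≥ 6 → h n ≡ 3 * h (n ∸ 1) + h (n ∸ 2) + 2 * h (n ∸ 3))
theorem2p16 = h≡total 1 , h≡total 2 , h≡total 3 , h≡total 4 , h≡total 5 , recurrence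
  where
    recurrence : ∀ n → n ≥ 6 → h n ≡ 3 * h (n ∸ 1) + h (n ∸ 2) + 2 * h (n ∸ 3)
    recurrence (suc (suc (suc k))) (s≤s (s≤s (s≤s _))) = h-recurrence k
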